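{- Let $\mu\ge 3$, let $T_2$ be a tree of diameter $2$ with central vertex $\mathtt{c}$, and consider a vertex-multiplication of $T_2\times K_\mu$ in which each vertex $w$ has multiplicity $s_w\ge 2$. Let $m=\min\{s_{\langle\mathtt{c},v\rangle}: v\in V(K_\mu)\}$. If $\deg_{T_2}(\mathtt{c})>\binom{m}{\lfloor m/2\rfloor}$, then this vertex-multiplication belongs to $\mathscr{C}_1$.
   Context: A tree of diameter 2 is a star; its central vertex $\mathtt{c}$ is the vertex adjacent to all others. $K_\mu$ is the complete graph on $\mu$ vertices. The cartesian product $G\times H$ has vertex set $\{\langle u,x\rangle: u\in V(G),x\in V(H)\}$, with $\langle u,x\rangle\langle v,y\rangle$ an edge iff either $u=v$ and $xy\in E(H)$, or $uv\in E(G)$ and $x=y$. For a graph $G$ and positive integers $s_w$ ($w\in V(G)$), the vertex-multiplication replaces each vertex $w$ by an independent set $V_w$ of size $s_w$, with $x\in V_u$, $y\in V_w$ adjacent iff $uw\in E(G)$. For a connected bridgeless graph $X$, $\bar d(X)$ is the minimum diameter of a strong orientation of $X$. $\mathscr{C}_1$ is the class of vertex-multiplications of a connected graph $G$ with all multiplicities $\ge 2$ whose orientation number equals $d(G)+1$, $d(G)$ being the diameter of $G$. -}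

module Defs where

open import Data.Nat using (ℕ; zero; suc; _≤_)
open import Data.Fin using (Fin)
open import Data.Product using (Σ; _×_; ∃; _,_)
open import Data.Sum using (_⊎_)
open import Data.Empty using (⊥)
open import Relation.Nullary using (¬_)
open import Relation.Binary.PropositionalEquality using (_≡_; _≢_)

record Graph : Set₁ where
  field
    V   : Set
    Adj : V → V → Set
open Graph public

-- Walk-reachability within at most k steps along a binary relation R.
data Reach {A : Set} (R : A → A → Set) : ℕ → A → A → Set where
  here : ∀ {k u} → Reach R k u u
  step : ∀ {k u w v} → R u w → Reach R k w v → Reach R (suc k) u v

Connected : Graph → Set
Connected G = ∀ u v → ∃ λ k → Reach (Adj G) k u v

IsDiameter : Graph → ℕ → Set
IsDiameter G zero    = ∀ u v → Reach (Adj G) zero u v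
IsDiameter G (suc d) = (∀ u v → Reach (Adj G) (suc d) u v)
                     × Σ (V G) λ u → Σ (V G) λ v → ¬ Reach (Adj G) d u v

record Orientation (G : Graph) : Set₁ where
  field
    Arc    : V G → V G → Set
    arc⊆   : ∀ {u v} → Arc u v → Adj G u v
    total  : ∀ {u v} → Adj G u v → Arc u v ⊎ Arc v u
    antisym : ∀ {u v} → Arc u v → Arc v u → ⊥
open Orientation public

Strong : {G : Graph} → Orientation G → Set
Strong {G} D = ∀ u v → ∃ λ k → Reach (Arc D) k u v

OrientationNumber : Graph → ℕ → Set₁
OrientationNumber X k =
  (Σ (Orientation X) λ D → Strong D × (∀ u v → Reach (Arc D) k u v))
  × (∀ (D : Orientation X) → Strong D → ∀ j → suc j ≡ k →
       Σ (V X) λ u → Σ (V X) λ v → ¬ Reach (Arc D) j u v)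

VertexMult : (G : Graph) → (V G → ℕ) → Graph
VertexMult G s = record
  { V   = Σ (V G) (λ w → Fin (s w))
  ; Adj = λ { (u , _) (w , _) → Adj G u w } }

InC1 : (G : Graph) → (V G → ℕ) → Set₁
InC1 G s = Connected G × (∀ w → 2 ≤ s w)
         × Σ ℕ λ d → IsDiameter G d × OrientationNumber (VertexMult G s) (suc d)

Star : ℕ → Graph
Star k = record
  { V   = Fin (suc k)
  ; Adj = λ x y → (x ≡ Fin.zero × y ≢ Fin.zero) ⊎ (y ≡ Fin.zero × x ≢ Fin.zero) }

Complete : ℕ → Graph
Complete μ = record { V = Fin μ ; Adj = λ x y → x ≢ y }

_□_ : Graph → Graph → Graph
G □ H = record
  { V   = V G × V H
  ; Adj = λ { (u , x) (v , y) → (u ≡ v × Adj H x y) ⊎ (Adj G u v × x ≡ y) } }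

-- T₂ × K_μ has diameter 3 (leaf, centre, centre, leaf), so what has to be shown is d̄ = 4.
--
-- Upper bound: call copy 0 of a class low and the other copies high. Within a row orient high → low,
-- and between copies of equal level descend along the order of K_μ; the low centre copy of a column
-- points to all leaf copies of that column, and leaf copies point to the high centre copies. Every
-- vertex then reaches the low centre copy of any column within 3 steps, hence every vertex within 4.
--
-- Lower bound: in any orientation, a walk of length ≤ 3 between copies of two different leaves in the
-- same column v must be leaf → z → leaf for a copy z of the centre class ⟨𝚌,v⟩. Fixing one copy of each
-- leaf and recording the centre copies it points to gives k subsets of an m-set. As k > C(m,⌊m/2⌋),
-- Sperner's theorem yields two nested ones, and for those two leaves no such z exists.

module Submission where

open import Defs
open import Algebra.Properties.CommutativeSemigroup using (x∙yz≈y∙xz)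
open import Data.Bool using (if_then_else_)
open import Data.Empty using (⊥; ⊥-elim)
open import Data.Fin as Fin using (Fin; zero; suc)
open import Data.Fin.Properties using (_≟_; <-cmp; <-asym; <⇒≢; ¬∀⟶∃¬; any?)
open import Data.Fin.Subset
  using (Subset; Side; inside; outside; _∈_; _∉_; _⊆_; _⊈_; ∣_∣; _─_; _-_; ⁅_⁆; ⊤)
open import Data.Fin.Subset.Properties
  using ( _∈?_; _⊆?_; drop-∷-⊆; ⊆-antisym; ⊆-trans; ⊆⊤; ∣⁅x⁆∣≡1; x∈⁅y⁆⇒x≡y; x∈p∧x≢y⇒x∈p-y
        ; p⊂q⇒∣p∣<∣q∣; ∣⊤∣≡n; ∣p∣≤n )
open import Data.List as List using (List; []; _∷_; map; filter)
open import Data.List.Relation.Unary.All as All using (All; []; _∷_; lookupWith)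
import Data.List.Relation.Unary.All.Properties as Allₚ
open import Data.List.Relation.Unary.AllPairs using (AllPairs; _∷_)
import Data.List.Relation.Unary.AllPairs.Properties as AllPairs
open import Data.List.Relation.Unary.Any as Any using (Any; here; there)
open import Data.Nat using (ℕ; zero; suc; _+_; _*_; _∸_; _≤_; _<_; z≤n; s≤s; s≤s⁻¹; _!)
open import Data.Nat.Combinatorics using (_C_; nCk≡n!/k![n-k]!; k![n∸k]!∣n!)
open import Data.Nat.DivMod using (_/_; _%_; m/n*n≤m; m%n<n; m≡m%n+[m/n]*n; m/n*n≡m)
open import Data.Nat.ListAction using (sum)
open import Data.Nat.Properties
  using ( +-suc; +-comm; +-identityʳ; *-identityʳ; *-zeroʳ; *-comm; *-assoc; *-distribˡ-+; +-∸-assoc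
        ; m+n∸n≡m; m+n∸m≡n; m+[n∸m]≡n; m∸[m∸n]≡n; n∸n≡0; ∸-mono; ∸-monoˡ-≤; suc-injective; n≮0
        ; ≤-refl; ≤-reflexive; ≤-trans; m≤m+n; m≤n+m; n≤1+n; m≤n⇒m<n∨m≡n; _≤?_; ≰⇒>; <⇒≱
        ; +-mono-≤; +-monoˡ-≤; +-monoʳ-≤; *-monoˡ-≤; *-monoʳ-≤; *-cancelʳ-≤; _!*_!≢0
        ; *-commutativeSemigroup; +-*-semiring; module ≤-Reasoning )
open import Algebra.Properties.Semiring.Sum +-*-semiring
  using (sum-syntax; ∑-distrib-+; sum-cong-≗; sum-replicate-zero; *-distribʳ-sum)
open import Data.Product using (Σ; ∃; ∃₂; _,_; _×_; proj₁)
open import Data.Sum using (_⊎_; inj₁; inj₂; [_,_]′)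
open import Data.Vec as Vec using ([]; _∷_; lookup; tabulate)
open import Data.Vec.Properties using (lookup∘tabulate; []=⇒lookup; lookup⇒[]=)
open import Function using (_∘_; const)
open import Relation.Binary using (tri<; tri≈; tri>)
open import Relation.Binary.PropositionalEquality
  using (_≡_; _≢_; ≢-sym; refl; sym; trans; cong; cong₂; subst; module ≡-Reasoning)
open import Relation.Nullary using (¬_; Dec; yes; no; ¬?)
open import Relation.Nullary.Decidable using (decidable-stable; _→-dec_; _×-dec_)

-- Sperner's theorem, via the LYM inequality

𝟙 : Side → ℕ
𝟙 inside  = 1
𝟙 outside = 0

∑𝟙-lookup≡∣p∣ : ∀ {m} (p : Subset m) → ∑[ x < m ] 𝟙 (lookup p x) ≡ ∣ p ∣
∑𝟙-lookup≡∣p∣ []            = refl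
∑𝟙-lookup≡∣p∣ (inside ∷ p)  = cong suc (∑𝟙-lookup≡∣p∣ p)
∑𝟙-lookup≡∣p∣ (outside ∷ p) = ∑𝟙-lookup≡∣p∣ p

∑-mono-≤ : ∀ {n} {f g : Fin n → ℕ} → (∀ i → f i ≤ g i) → ∑[ i < n ] f i ≤ ∑[ i < n ] g i
∑-mono-≤ {zero}  _   = z≤n
∑-mono-≤ {suc n} f≤g = +-mono-≤ (f≤g zero) (∑-mono-≤ (f≤g ∘ suc))

lookup-─ : ∀ {m} (p q : Subset m) x → lookup (p ─ q) x ≡ (if lookup q x then outside else lookup p x)
lookup-─ (_ ∷ _) (inside  ∷ _) zero    = refl
lookup-─ (_ ∷ _) (outside ∷ _) zero    = refl
lookup-─ (_ ∷ p) (_ ∷ q)       (suc x) = lookup-─ p q x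

x∉p⇒lookup≡outside : ∀ {m} {x : Fin m} (p : Subset m) → x ∉ p → lookup p x ≡ outside
x∉p⇒lookup≡outside {x = x} p x∉p with lookup p x in e
... | inside  = ⊥-elim (x∉p (lookup⇒[]= x p e))
... | outside = refl

q⊆p⇒∣p─q∣+∣q∣≡∣p∣ : ∀ {m} (p q : Subset m) → q ⊆ p → ∣ p ─ q ∣ + ∣ q ∣ ≡ ∣ p ∣
q⊆p⇒∣p─q∣+∣q∣≡∣p∣ []            []            _   = refl
q⊆p⇒∣p─q∣+∣q∣≡∣p∣ (inside ∷ p)  (inside ∷ q)  q⊆p =
  trans (+-suc _ _) (cong suc (q⊆p⇒∣p─q∣+∣q∣≡∣p∣ p q (drop-∷-⊆ q⊆p)))
q⊆p⇒∣p─q∣+∣q∣≡∣p∣ (outside ∷ p) (inside ∷ q)  q⊆p with () ← q⊆p Vec.here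
q⊆p⇒∣p─q∣+∣q∣≡∣p∣ (inside ∷ p)  (outside ∷ q) q⊆p = cong suc (q⊆p⇒∣p─q∣+∣q∣≡∣p∣ p q (drop-∷-⊆ q⊆p))
q⊆p⇒∣p─q∣+∣q∣≡∣p∣ (outside ∷ p) (outside ∷ q) q⊆p = q⊆p⇒∣p─q∣+∣q∣≡∣p∣ p q (drop-∷-⊆ q⊆p)

x∈p⇒1+∣p-x∣≡∣p∣ : ∀ {m} {x : Fin m} (p : Subset m) → x ∈ p → suc ∣ p - x ∣ ≡ ∣ p ∣
x∈p⇒1+∣p-x∣≡∣p∣ {x = x} p x∈p = begin
  suc ∣ p - x ∣          ≡⟨ +-comm 1 _ ⟩
  ∣ p - x ∣ + 1          ≡⟨ cong (∣ p - x ∣ +_) (∣⁅x⁆∣≡1 x) ⟨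
  ∣ p - x ∣ + ∣ ⁅ x ⁆ ∣  ≡⟨ q⊆p⇒∣p─q∣+∣q∣≡∣p∣ p ⁅ x ⁆ ⁅x⁆⊆p ⟩
  ∣ p ∣                  ∎
  where
  open ≡-Reasoning
  ⁅x⁆⊆p : ⁅ x ⁆ ⊆ p
  ⁅x⁆⊆p y∈⁅x⁆ = subst (_∈ p) (sym (x∈⁅y⁆⇒x≡y x y∈⁅x⁆)) x∈p

q⊆p∧x∉q⇒q⊆p-x : ∀ {m} {x : Fin m} {p q : Subset m} → q ⊆ p → x ∉ q → q ⊆ p - x
q⊆p∧x∉q⇒q⊆p-x q⊆p x∉q y∈q = x∈p∧x≢y⇒x∈p-y (q⊆p y∈q) (λ { refl → x∉q y∈q })

p⊈q⇒witness : ∀ {m} {p q : Subset m} → p ⊈ q → ∃ λ x → x ∈ p × x ∉ q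
p⊈q⇒witness {p = p} {q} p⊈q with ¬∀⟶∃¬ _ _ (λ x → x ∈? p →-dec x ∈? q) (λ p⊆q → p⊈q (p⊆q _))
... | x , x∈p⇏x∈q = x , decidable-stable (x ∈? p) (λ x∉p → x∈p⇏x∈q (⊥-elim ∘ x∉p)) , x∈p⇏x∈q ∘ const

q⊆p∧p⊈q⇒∣q∣<∣p∣ : ∀ {m} {p q : Subset m} → q ⊆ p → p ⊈ q → ∣ q ∣ < ∣ p ∣
q⊆p∧p⊈q⇒∣q∣<∣p∣ q⊆p p⊈q = let x , x∈p , x∉q = p⊈q⇒witness p⊈q in p⊂q⇒∣p∣<∣q∣ (q⊆p , x , x∈p , x∉q)

_∉?_ : ∀ {m} (x : Fin m) (A : Subset m) → Dec (x ∉ A)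
x ∉? A = ¬? (x ∈? A)

avoiding : ∀ {m} → Fin m → List (Subset m) → List (Subset m)
avoiding x = filter (x ∉?_)

Incomparable : ∀ {m} → Subset m → Subset m → Set
Incomparable A B = A ⊈ B × B ⊈ A

Antichain : ∀ {m} → List (Subset m) → Set
Antichain = AllPairs Incomparable

-- a!(n∸a)! is the number of maximal chains of an n-set through a fixed a-subset,
-- so the LYM inequality reads chainCount n F ≤ n!.
chainWeight : ℕ → ℕ → ℕ
chainWeight n a = a ! * (n ∸ a) !

chainCount : ∀ {m} → ℕ → List (Subset m) → ℕ
chainCount n F = sum (map (chainWeight n ∘ ∣_∣) F)

chainWeight-suc : ∀ {n a} → a ≤ n → chainWeight (suc n) a ≡ (suc n ∸ a) * chainWeight n a
chainWeight-suc {n} {a} a≤n rewrite +-∸-assoc 1 a≤n =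
  x∙yz≈y∙xz *-commutativeSemigroup (a !) (suc (n ∸ a)) ((n ∸ a) !)

-- A maximal chain of S through A passes through S - x for exactly one x ∈ S ─ A.
chainWeight-suc-∑ : ∀ {m n} (S A : Subset m) → A ⊆ S → ∣ S ∣ ≡ suc n → ∣ A ∣ ≤ n →
                    chainWeight (suc n) ∣ A ∣ ≡ ∑[ x < m ] (𝟙 (lookup (S ─ A) x) * chainWeight n ∣ A ∣)
chainWeight-suc-∑ {m} {n} S A A⊆S ∣S∣≡1+n ∣A∣≤n = begin
  chainWeight (suc n) ∣ A ∣                   ≡⟨ chainWeight-suc ∣A∣≤n ⟩
  (suc n ∸ ∣ A ∣) * c                         ≡⟨ cong (_* c) ∣S─A∣≡1+n∸∣A∣ ⟨
  ∣ S ─ A ∣ * c                               ≡⟨ cong (_* c) (∑𝟙-lookup≡∣p∣ (S ─ A)) ⟨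
  (∑[ x < m ] 𝟙 (lookup (S ─ A) x)) * c       ≡⟨ *-distribʳ-sum c (𝟙 ∘ lookup (S ─ A)) ⟩
  ∑[ x < m ] (𝟙 (lookup (S ─ A) x) * c)       ∎
  where
  open ≡-Reasoning
  c = chainWeight n ∣ A ∣
  ∣S─A∣≡1+n∸∣A∣ : ∣ S ─ A ∣ ≡ suc n ∸ ∣ A ∣
  ∣S─A∣≡1+n∸∣A∣ =
    trans (sym (m+n∸n≡m _ ∣ A ∣)) (cong (_∸ ∣ A ∣) (trans (q⊆p⇒∣p─q∣+∣q∣≡∣p∣ S A A⊆S) ∣S∣≡1+n))

double-count-∷ : ∀ {m n} (S A : Subset m) (F : List (Subset m)) x →
                 𝟙 (lookup (S ─ A) x) * chainWeight n ∣ A ∣ + 𝟙 (lookup S x) * chainCount n (avoiding x F)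
                 ≡ 𝟙 (lookup S x) * chainCount n (avoiding x (A ∷ F))
double-count-∷ {n = n} S A F x rewrite lookup-─ S A x with x ∈? A
... | yes x∈A rewrite []=⇒lookup x∈A = refl
... | no x∉A rewrite x∉p⇒lookup≡outside A x∉A =
  sym (*-distribˡ-+ (𝟙 (lookup S x)) (chainWeight n ∣ A ∣) (chainCount n (avoiding x F)))

double-count : ∀ {m n} (S : Subset m) → ∣ S ∣ ≡ suc n → (F : List (Subset m)) →
               All (λ A → A ⊆ S × ∣ A ∣ ≤ n) F →
               chainCount (suc n) F ≡ ∑[ x < m ] (𝟙 (lookup S x) * chainCount n (avoiding x F))
double-count {m} S _ [] [] =
  sym (trans (sum-cong-≗ (λ x → *-zeroʳ (𝟙 (lookup S x)))) (sum-replicate-zero m))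
double-count {m} {n} S ∣S∣≡1+n (A ∷ F) ((A⊆S , ∣A∣≤n) ∷ F-ok) = begin
  chainWeight (suc n) ∣ A ∣ + chainCount (suc n) F
    ≡⟨ cong₂ _+_ (chainWeight-suc-∑ S A A⊆S ∣S∣≡1+n ∣A∣≤n) (double-count S ∣S∣≡1+n F F-ok) ⟩
  ∑[ x < m ] fromA x + ∑[ x < m ] fromF x
    ≡⟨ ∑-distrib-+ fromA fromF ⟨
  ∑[ x < m ] (fromA x + fromF x)
    ≡⟨ sum-cong-≗ (double-count-∷ S A F) ⟩
  ∑[ x < m ] (𝟙 (lookup S x) * chainCount n (avoiding x (A ∷ F))) ∎
  where
  open ≡-Reasoning
  fromA fromF : Fin m → ℕ
  fromA x = 𝟙 (lookup (S ─ A) x) * chainWeight n ∣ A ∣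
  fromF x = 𝟙 (lookup S x) * chainCount n (avoiding x F)

chainCount-top : ∀ {m} (S : Subset m) (F : List (Subset m)) → All (_⊆ S) F → Antichain F →
                 Any (S ⊆_) F → chainCount ∣ S ∣ F ≡ ∣ S ∣ !
chainCount-top S (A ∷ []) (A⊆S ∷ []) _ (here S⊆A)
  rewrite ⊆-antisym A⊆S S⊆A | n∸n≡0 ∣ S ∣ = trans (+-identityʳ _) (*-identityʳ _)
chainCount-top S (A ∷ B ∷ _) (_ ∷ B⊆S ∷ _) (((_ , B⊈A) ∷ _) ∷ _) (here S⊆A) =
  ⊥-elim (B⊈A (⊆-trans B⊆S S⊆A))
chainCount-top S (A ∷ F) (A⊆S ∷ _) (A∥F ∷ _) (there S⊆B∈F) =
  ⊥-elim (lookupWith A-not-below A∥F S⊆B∈F)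
  where
  A-not-below : ∀ {B} → Incomparable A B → S ⊆ B → ⊥
  A-not-below (A⊈B , _) S⊆B = A⊈B (⊆-trans A⊆S S⊆B)

LYM : ℕ → Set
LYM n = ∀ {m} (S : Subset m) → ∣ S ∣ ≡ n → (F : List (Subset m)) → All (_⊆ S) F → Antichain F →
        chainCount n F ≤ n !

avoiding-⊆ : ∀ {m} {S : Subset m} x (F : List (Subset m)) → All (_⊆ S) F →
             All (_⊆ S - x) (avoiding x F)
avoiding-⊆ {S = S} x F F⊆S =
  All.zipWith avoid (Allₚ.filter⁺ (x ∉?_) F⊆S , Allₚ.all-filter (x ∉?_) F)
  where
  avoid : ∀ {A} → A ⊆ S × x ∉ A → A ⊆ S - x
  avoid (A⊆S , x∉A) = q⊆p∧x∉q⇒q⊆p-x A⊆S x∉A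

lym-proper : ∀ {n} → LYM n → ∀ {m} (S : Subset m) → ∣ S ∣ ≡ suc n → (F : List (Subset m)) →
             All (λ A → A ⊆ S × S ⊈ A) F → Antichain F → chainCount (suc n) F ≤ suc n !
lym-proper {n} lymₙ {m} S ∣S∣≡1+n F F⊂S anti = begin
  chainCount (suc n) F
    ≡⟨ double-count S ∣S∣≡1+n F (All.map bounded F⊂S) ⟩
  ∑[ x < m ] (𝟙 (lookup S x) * chainCount n (avoiding x F))
    ≤⟨ ∑-mono-≤ avoiding-bound ⟩
  ∑[ x < m ] (𝟙 (lookup S x) * n !)
    ≡⟨ *-distribʳ-sum (n !) (𝟙 ∘ lookup S) ⟨
  (∑[ x < m ] 𝟙 (lookup S x)) * n !
    ≡⟨ cong (_* n !) (trans (∑𝟙-lookup≡∣p∣ S) ∣S∣≡1+n) ⟩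
  suc n * n ! ∎
  where
  open ≤-Reasoning
  bounded : ∀ {A} → A ⊆ S × S ⊈ A → A ⊆ S × ∣ A ∣ ≤ n
  bounded (A⊆S , S⊈A) = A⊆S , s≤s⁻¹ (subst (_ <_) ∣S∣≡1+n (q⊆p∧p⊈q⇒∣q∣<∣p∣ A⊆S S⊈A))
  avoiding-bound : ∀ x → 𝟙 (lookup S x) * chainCount n (avoiding x F) ≤ 𝟙 (lookup S x) * n !
  avoiding-bound x with lookup S x in x∈S
  ... | outside = z≤n
  ... | inside  = *-monoʳ-≤ 1 (lymₙ (S - x) ∣S-x∣≡n (avoiding x F)
                                (avoiding-⊆ x F (All.map proj₁ F⊂S)) (AllPairs.filter⁺ (x ∉?_) anti))
    where
    ∣S-x∣≡n : ∣ S - x ∣ ≡ n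
    ∣S-x∣≡n = suc-injective (trans (x∈p⇒1+∣p-x∣≡∣p∣ S (lookup⇒[]= x S x∈S)) ∣S∣≡1+n)

lym : ∀ n → LYM n
lym n S ∣S∣≡n F F⊆S anti with Any.any? (S ⊆?_) F
... | yes S⊆A∈F =
  ≤-reflexive (subst (λ n → chainCount n F ≡ n !) ∣S∣≡n (chainCount-top S F F⊆S anti S⊆A∈F))
lym zero    S ∣S∣≡0    []      _         _    | no _   = z≤n
lym zero    S ∣S∣≡0    (A ∷ _) (A⊆S ∷ _) _    | no S⊈F =
  ⊥-elim (n≮0 (subst (∣ A ∣ <_) ∣S∣≡0 (q⊆p∧p⊈q⇒∣q∣<∣p∣ A⊆S (S⊈F ∘ here))))
lym (suc n) S ∣S∣≡1+n F        F⊆S       anti | no S⊈F =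
  lym-proper (lym n) S ∣S∣≡1+n F (All.zip (F⊆S , Allₚ.¬Any⇒All¬ F S⊈F)) anti

chainWeight-step : ∀ {m a} → suc (a + a) ≤ m → chainWeight m (suc a) ≤ chainWeight m a
chainWeight-step {m} {a} 2a<m =
  subst (λ m → chainWeight m (suc a) ≤ chainWeight m a) (m+[n∸m]≡n 1+a≤m) (split a≤t)
  where
  t = m ∸ suc a
  1+a≤m : suc a ≤ m
  1+a≤m = ≤-trans (s≤s (m≤m+n a a)) 2a<m
  a≤t : a ≤ t
  a≤t = subst (_≤ t) (m+n∸m≡n (suc a) a) (∸-monoˡ-≤ (suc a) 2a<m)
  split : a ≤ t → chainWeight (suc a + t) (suc a) ≤ chainWeight (suc a + t) a
  split a≤t rewrite m+n∸m≡n a t | +-∸-assoc 1 (m≤m+n a t) | m+n∸m≡n a t = begin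
    suc a * a ! * t !      ≡⟨ *-assoc (suc a) (a !) (t !) ⟩
    suc a * (a ! * t !)    ≤⟨ *-monoˡ-≤ (a ! * t !) (s≤s a≤t) ⟩
    suc t * (a ! * t !)    ≡⟨ x∙yz≈y∙xz *-commutativeSemigroup (suc t) (a !) (t !) ⟩
    a ! * (suc t * t !)    ∎
    where open ≤-Reasoning

chainWeight-antitone : ∀ {m a b} → a ≤ b → b + b ≤ m → chainWeight m b ≤ chainWeight m a
chainWeight-antitone a≤b 2b≤m with m≤n⇒m<n∨m≡n a≤b
... | inj₂ refl = ≤-refl
... | inj₁ (s≤s {n = b} a≤b) =
  ≤-trans (chainWeight-step {a = b} 2b<m) (chainWeight-antitone a≤b (≤-trans (n≤1+n _) 2b<m))
  where
  2b<m : suc (b + b) ≤ _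
  2b<m = ≤-trans (s≤s (+-monoʳ-≤ b (n≤1+n b))) 2b≤m

m/2*2≡m/2+m/2 : ∀ m → m / 2 * 2 ≡ m / 2 + m / 2
m/2*2≡m/2+m/2 m = trans (*-comm (m / 2) 2) (cong (m / 2 +_) (+-identityʳ (m / 2)))

m/2+m/2≤m : ∀ m → m / 2 + m / 2 ≤ m
m/2+m/2≤m m = subst (_≤ m) (m/2*2≡m/2+m/2 m) (m/n*n≤m m 2)

m≤1+m/2+m/2 : ∀ m → m ≤ suc (m / 2 + m / 2)
m≤1+m/2+m/2 m = begin
  m                            ≡⟨ m≡m%n+[m/n]*n m 2 ⟩
  m % 2 + m / 2 * 2            ≤⟨ +-monoˡ-≤ (m / 2 * 2) (s≤s⁻¹ (m%n<n m 2)) ⟩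
  1 + m / 2 * 2                ≡⟨ cong suc (m/2*2≡m/2+m/2 m) ⟩
  suc (m / 2 + m / 2)          ∎
  where open ≤-Reasoning

chainWeight-sym : ∀ {m a} → a ≤ m → chainWeight m (m ∸ a) ≡ chainWeight m a
chainWeight-sym {m} {a} a≤m rewrite m∸[m∸n]≡n a≤m = *-comm ((m ∸ a) !) (a !)

chainWeight-central-min : ∀ m a → a ≤ m → chainWeight m (m / 2) ≤ chainWeight m a
chainWeight-central-min m a a≤m with a ≤? m / 2
... | yes a≤h = chainWeight-antitone a≤h (m/2+m/2≤m m)
... | no  a≰h =
  subst (chainWeight m (m / 2) ≤_) (chainWeight-sym a≤m) (chainWeight-antitone m∸a≤h (m/2+m/2≤m m))
  where
  m∸a≤h : m ∸ a ≤ m / 2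
  m∸a≤h = subst (m ∸ a ≤_) (m+n∸m≡n (suc (m / 2)) (m / 2)) (∸-mono (m≤1+m/2+m/2 m) (≰⇒> a≰h))

nCk*chainWeight≡n! : ∀ {n k} → k ≤ n → (n C k) * chainWeight n k ≡ n !
nCk*chainWeight≡n! {n} {k} k≤n = trans (cong (_* chainWeight n k) (nCk≡n!/k![n-k]! k≤n))
                                       (m/n*n≡m {{k !* (n ∸ k) !≢0}} (k![n∸k]!∣n! k≤n))

k*central≤chainCount : ∀ {m} k (f : Fin k → Subset m) →
                       k * chainWeight m (m / 2) ≤ chainCount m (List.tabulate f)
k*central≤chainCount zero    f = z≤n
k*central≤chainCount {m} (suc k) f =
  +-mono-≤ (chainWeight-central-min m ∣ f zero ∣ (∣p∣≤n (f zero))) (k*central≤chainCount k (f ∘ suc))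

sperner-bound : ∀ {m k} (f : Fin k → Subset m) → (∀ {i j} → i ≢ j → f i ⊈ f j) → k ≤ m C (m / 2)
sperner-bound {m} {k} f incomparable =
  *-cancelʳ-≤ k (m C (m / 2)) (chainWeight m (m / 2)) {{(m / 2) !* (m ∸ m / 2) !≢0}} (begin
    k * chainWeight m (m / 2)
      ≤⟨ k*central≤chainCount k f ⟩
    chainCount m (List.tabulate f)
      ≤⟨ lym m ⊤ (∣⊤∣≡n m) (List.tabulate f) (Allₚ.tabulate⁺ (λ _ → ⊆⊤)) anti ⟩
    m !
      ≡⟨ nCk*chainWeight≡n! (≤-trans (m≤m+n (m / 2) (m / 2)) (m/2+m/2≤m m)) ⟨
    (m C (m / 2)) * chainWeight m (m / 2) ∎)
  where
  open ≤-Reasoning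
  anti : Antichain (List.tabulate f)
  anti = AllPairs.tabulate⁺ (λ i≢j → incomparable i≢j , incomparable (≢-sym i≢j))

sperner : ∀ {m k} (f : Fin k → Subset m) → m C (m / 2) < k → ∃₂ λ i j → i ≢ j × f i ⊆ f j
sperner f C<k with any? (λ i → any? (λ j → ¬? (i Fin.≟ j) ×-dec f i ⊆? f j))
... | yes (i , j , i≢j , fi⊆fj) = i , j , i≢j , fi⊆fj
... | no  none = ⊥-elim (<⇒≱ C<k (sperner-bound f (λ i≢j fi⊆fj → none (_ , _ , i≢j , fi⊆fj))))

module _ {A : Set} {R : A → A → Set} where

  Reach-mono : ∀ {m n x y} → m ≤ n → Reach R m x y → Reach R n x y
  Reach-mono _         here       = here
  Reach-mono (s≤s m≤n) (step r p) = step r (Reach-mono m≤n p)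

  Reach-trans : ∀ {m n x y z} → Reach R m x y → Reach R n y z → Reach R (m + n) x z
  Reach-trans {m} {n} here q = Reach-mono (m≤n+m n m) q
  Reach-trans (step r p) q = step r (Reach-trans p q)

  arc : ∀ {x y} → R x y → Reach R 1 x y
  arc r = step r here

Reach-map : ∀ {A B : Set} {R : A → A → Set} {S : B → B → Set} (f : A → B) →
            (∀ {x y} → R x y → S (f x) (f y)) → ∀ {n x y} → Reach R n x y → Reach S n (f x) (f y)
Reach-map f r⇒s here       = here
Reach-map f r⇒s (step r p) = step (r⇒s r) (Reach-map f r⇒s p)

side : ∀ {A B : Set} → A ⊎ B → Side
side = [ const inside , const outside ]′

inside⇒inj₁ : ∀ {A B : Set} (t : A ⊎ B) → side t ≡ inside → A
inside⇒inj₁ (inj₁ a) _ = a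

module _ {X : Graph} (D : Orientation X) (x : V X) {n} (y : Fin n → V X) (adj : ∀ a → Adj X x (y a)) where

  outSet : Subset n
  outSet = tabulate λ a → side (total D (adj a))

  ∈outSet⇒Arc : ∀ {a} → a ∈ outSet → Arc D x (y a)
  ∈outSet⇒Arc {a} a∈ = inside⇒inj₁ (total D (adj a)) (trans (sym (lookup∘tabulate _ a)) ([]=⇒lookup a∈))

  Arc⇒∈outSet : ∀ {a} → Arc D x (y a) → a ∈ outSet
  Arc⇒∈outSet {a} x⟶y = lookup⇒[]= a outSet (trans (lookup∘tabulate _ a) (arc-side (total D (adj a))))
    where
    arc-side : (t : Arc D x (y a) ⊎ Arc D (y a) x) → side t ≡ inside
    arc-side (inj₁ _)   = refl
    arc-side (inj₂ y⟶x) = ⊥-elim (antisym D x⟶y y⟶x)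

data Level : Set where
  low high : Level

level : ∀ {n} → Fin n → Level
level zero    = low
level (suc _) = high

low≢high : low ≢ high
low≢high ()

low-unique : ∀ {n} {a b : Fin n} → level a ≡ low → level b ≡ low → a ≡ b
low-unique {a = zero} {zero} _ _ = refl

lowFin : ∀ {n} → 2 ≤ n → Fin n
lowFin (s≤s _) = zero

highFin : ∀ {n} → 2 ≤ n → Fin n
highFin (s≤s (s≤s _)) = suc zero

level-lowFin : ∀ {n} (p : 2 ≤ n) → level (lowFin p) ≡ low
level-lowFin (s≤s _) = refl

level-highFin : ∀ {n} (p : 2 ≤ n) → level (highFin p) ≡ high
level-highFin (s≤s (s≤s _)) = refl

-- The cartesian product of a star and a complete graph

module StarProduct (k μ : ℕ) where

  G : Graph
  G = Star k □ Complete μ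

  Leaf : Fin (suc k) → Set
  Leaf i = i ≢ zero

  G-sym : ∀ {p q} → Adj G p q → Adj G q p
  G-sym (inj₁ (refl , v≢w))               = inj₁ (refl , λ e → v≢w (sym e))
  G-sym (inj₂ (inj₁ (refl , j≢0) , refl)) = inj₂ (inj₂ (refl , j≢0) , refl)
  G-sym (inj₂ (inj₂ (refl , i≢0) , refl)) = inj₂ (inj₁ (refl , i≢0) , refl)

  G-irrefl : ∀ {p} → ¬ Adj G p p
  G-irrefl (inj₁ (_ , v≢v))               = v≢v refl
  G-irrefl (inj₂ (inj₁ (refl , 0≢0) , _)) = 0≢0 refl
  G-irrefl (inj₂ (inj₂ (refl , 0≢0) , _)) = 0≢0 refl

  leaf-neighbour : ∀ {i j v w} → Leaf i → Adj G (i , v) (j , w) → (j ≡ i × v ≢ w) ⊎ (j ≡ zero × v ≡ w)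
  leaf-neighbour i≢0 (inj₁ (refl , v≢w))           = inj₁ (refl , v≢w)
  leaf-neighbour i≢0 (inj₂ (inj₁ (i≡0 , _) , _))   = ⊥-elim (i≢0 i≡0)
  leaf-neighbour i≢0 (inj₂ (inj₂ (j≡0 , _) , v≡w)) = inj₂ (j≡0 , v≡w)

  leaves-apart : ∀ {i₁ i₂ v₁ v₂} → Leaf i₁ → Leaf i₂ → i₁ ≢ i₂ → v₁ ≢ v₂ →
                 ¬ Reach (Adj G) 2 (i₁ , v₁) (i₂ , v₂)
  leaves-apart _   _   i₁≢i₂ _ here = i₁≢i₂ refl
  leaves-apart l₁ l₂ i₁≢i₂ _ (step p here) with leaf-neighbour l₁ p
  ... | inj₁ (refl , _) = i₁≢i₂ refl
  ... | inj₂ (refl , _) = l₂ refl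
  leaves-apart l₁ l₂ i₁≢i₂ v₁≢v₂ (step p (step q here))
    with leaf-neighbour l₁ p | leaf-neighbour l₂ (G-sym q)
  ... | inj₁ (refl , _) | inj₁ (refl , _) = i₁≢i₂ refl
  ... | inj₁ (refl , _) | inj₂ (refl , _) = l₁ refl
  ... | inj₂ (refl , _) | inj₁ (refl , _) = l₂ refl
  ... | inj₂ (refl , refl) | inj₂ (_ , refl) = v₁≢v₂ refl

  hub-leaf-no-common-neighbour : ∀ {i v w} → Leaf i → ¬ (Adj G (zero , v) w × Adj G w (i , v))
  hub-leaf-no-common-neighbour l (p , q) with leaf-neighbour l (G-sym q)
  ... | inj₁ (refl , w≢v) with leaf-neighbour l (G-sym p)
  ...   | inj₁ (0≡i , _)     = l (sym 0≡i)
  ...   | inj₂ (_ , v≡w)     = w≢v (sym v≡w)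
  hub-leaf-no-common-neighbour l (p , q) | inj₂ (refl , refl) = G-irrefl p

  to-hub : ∀ i v → Reach (Adj G) 1 (i , v) (zero , v)
  to-hub zero    v = here
  to-hub (suc i) v = arc (inj₂ (inj₂ (refl , λ ()) , refl))

  from-hub : ∀ j w → Reach (Adj G) 1 (zero , w) (j , w)
  from-hub zero    w = here
  from-hub (suc j) w = arc (inj₂ (inj₁ (refl , λ ()) , refl))

  across-hubs : ∀ v w → Reach (Adj G) 1 (zero , v) (zero , w)
  across-hubs v w with v ≟ w
  ... | yes refl = here
  ... | no v≢w   = arc (inj₁ (refl , v≢w))

  G-diameter≤3 : ∀ p q → Reach (Adj G) 3 p q
  G-diameter≤3 (i , v) (j , w) = Reach-trans (to-hub i v) (Reach-trans (across-hubs v w) (from-hub j w))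

  G-diameter≡3 : ∀ {i₁ i₂ v₁ v₂} → Leaf i₁ → Leaf i₂ → i₁ ≢ i₂ → v₁ ≢ v₂ → IsDiameter G 3
  G-diameter≡3 l₁ l₂ i₁≢i₂ v₁≢v₂ = G-diameter≤3 , _ , _ , leaves-apart l₁ l₂ i₁≢i₂ v₁≢v₂

  module Multiplication (s : Fin (suc k) × Fin μ → ℕ) (s≥2 : ∀ w → 2 ≤ s w) where

    Gˢ : Graph
    Gˢ = VertexMult G s

    lo hi : ∀ w → Fin (s w)
    lo w = lowFin (s≥2 w)
    hi w = highFin (s≥2 w)

    lo-low : ∀ w → level (lo w) ≡ low
    lo-low w = level-lowFin (s≥2 w)

    hi-high : ∀ w → level (hi w) ≡ high
    hi-high w = level-highFin (s≥2 w)

    through-hub : (D : Orientation Gˢ) → ∀ {i₁ i₂ v a₁ a₂} → Leaf i₁ → Leaf i₂ → i₁ ≢ i₂ →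
                  Reach (Arc D) 3 ((i₁ , v) , a₁) ((i₂ , v) , a₂) →
                  ∃ λ c → Arc D ((i₁ , v) , a₁) ((zero , v) , c) × Arc D ((zero , v) , c) ((i₂ , v) , a₂)
    through-hub D l₁ l₂ i₁≢i₂ here = ⊥-elim (i₁≢i₂ refl)
    through-hub D l₁ l₂ i₁≢i₂ (step {w = (_ , c)} r p) with leaf-neighbour l₁ (arc⊆ D r)
    ... | inj₁ (refl , v≢w)  = ⊥-elim (leaves-apart l₁ l₂ i₁≢i₂ (≢-sym v≢w) (Reach-map proj₁ (arc⊆ D) p))
    ... | inj₂ (refl , refl) with p
    ...   | here                = ⊥-elim (l₂ refl)
    ...   | step r′ here        = c , r , r′
    ...   | step r′ (step r″ here) = ⊥-elim (hub-leaf-no-common-neighbour l₂ (arc⊆ D r′ , arc⊆ D r″))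

    module _ (D : Orientation Gˢ) (v : Fin μ) where

      leaf : Fin k → V Gˢ
      leaf ℓ = ((suc ℓ , v) , lo _)

      hub : Fin (s (zero , v)) → V Gˢ
      hub c = ((zero , v) , c)

      leafOut : Fin k → Subset (s (zero , v))
      leafOut ℓ = outSet D (leaf ℓ) hub (λ _ → inj₂ (inj₂ (refl , λ ()) , refl))

      nested-leaves-apart : ∀ {ℓ₁ ℓ₂} → ℓ₁ ≢ ℓ₂ → leafOut ℓ₁ ⊆ leafOut ℓ₂ →
                            ¬ Reach (Arc D) 3 (leaf ℓ₁) (leaf ℓ₂)
      nested-leaves-apart ℓ₁≢ℓ₂ out₁⊆out₂ r =
        let c , ℓ₁⟶c , c⟶ℓ₂ = through-hub D (λ ()) (λ ()) (λ { refl → ℓ₁≢ℓ₂ refl }) r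
        in antisym D (∈outSet⇒Arc D _ hub _ (out₁⊆out₂ (Arc⇒∈outSet D _ hub _ ℓ₁⟶c))) c⟶ℓ₂

    diameter>3 : (v : Fin μ) → s (zero , v) C (s (zero , v) / 2) < k → (D : Orientation Gˢ) →
                 Σ (V Gˢ) λ x → Σ (V Gˢ) λ y → ¬ Reach (Arc D) 3 x y
    diameter>3 v many-leaves D =
      let ℓ₁ , ℓ₂ , ℓ₁≢ℓ₂ , out₁⊆out₂ = sperner (leafOut D v) many-leaves
      in leaf D v ℓ₁ , leaf D v ℓ₂ , nested-leaves-apart D v ℓ₁≢ℓ₂ out₁⊆out₂

    module Orientation₄ (ℓ : Fin k) (another : (v : Fin μ) → ∃ λ u → u ≢ v) where

      infix 4 _⟶_
      data _⟶_ : V Gˢ → V Gˢ → Set where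
        high⇒low : ∀ {i v w a b} → v ≢ w → level a ≡ high → level b ≡ low → ((i , v) , a) ⟶ ((i , w) , b)
        descend  : ∀ {i v w a b} → w Fin.< v → level a ≡ level b → ((i , v) , a) ⟶ ((i , w) , b)
        hub⇒leaf : ∀ {i v a b} → Leaf i → level a ≡ low → ((zero , v) , a) ⟶ ((i , v) , b)
        leaf⇒hub : ∀ {i v a b} → Leaf i → level b ≡ high → ((i , v) , a) ⟶ ((zero , v) , b)

      leaf⇒high-hub : ∀ {i v a} → ((suc i , v) , a) ⟶ ((zero , v) , hi _)
      leaf⇒high-hub = leaf⇒hub (λ ()) (hi-high _)

      hi⇒lo : ∀ {i v w} → v ≢ w → ((i , v) , hi _) ⟶ ((i , w) , lo _)
      hi⇒lo v≢w = high⇒low v≢w (hi-high _) (lo-low _)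

      high-reaches-low : ∀ {i v w a b} → level a ≡ high → level b ≡ low →
                         Reach _⟶_ 2 ((i , v) , a) ((i , w) , b)
      high-reaches-low {i} {v} {w} ha lb with v ≟ w
      ... | no v≢w = Reach-mono (n≤1+n 1) (arc (high⇒low v≢w ha lb))
      ... | yes refl with another v
      ...   | u , u≢v with <-cmp u v
      ...     | tri< u<v _ _ = step (descend u<v (trans ha (sym (hi-high (i , u)))))
                                    (arc (high⇒low u≢v (hi-high _) lb))
      ...     | tri≈ _ u≡v _ = ⊥-elim (u≢v u≡v)
      ...     | tri> _ _ v<u = step (high⇒low (≢-sym u≢v) ha (lo-low (i , u)))
                                    (arc (descend v<u (trans (lo-low _) (sym lb))))

      low-hub-reaches-high-hub : ∀ {v a b} → level a ≡ low → level b ≡ high →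
                                 Reach _⟶_ 2 ((zero , v) , a) ((zero , v) , b)
      low-hub-reaches-high-hub {v} la hb =
        step {w = ((suc ℓ , v) , lo _)} (hub⇒leaf (λ ()) la) (arc (leaf⇒hub (λ ()) hb))

      reaches-low-hub : ∀ x w {b} → level b ≡ low → Reach _⟶_ 3 x ((zero , w) , b)
      reaches-low-hub ((suc i , v) , a) w lb = step leaf⇒high-hub (high-reaches-low (hi-high _) lb)
      reaches-low-hub ((zero , v) , a) w lb with level a in la
      ... | high = Reach-mono (n≤1+n 2) (high-reaches-low la lb)
      ... | low with v ≟ w
      ...   | yes refl rewrite low-unique la lb = here
      ...   | no v≢w   =
        Reach-trans (low-hub-reaches-high-hub la (hi-high _)) (arc (high⇒low v≢w (hi-high _) lb))

      reaches-high-hub : ∀ x w {b} → level b ≡ high → Reach _⟶_ 4 x ((zero , w) , b)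
      reaches-high-hub ((suc i , v) , a) w hb with v ≟ w
      ... | yes refl = Reach-mono (s≤s z≤n) (arc (leaf⇒hub (λ ()) hb))
      ... | no v≢w   = step leaf⇒high-hub (step (hi⇒lo v≢w) (low-hub-reaches-high-hub (lo-low _) hb))
      reaches-high-hub ((zero , v) , a) w hb with level a in la
      ... | high =
        Reach-trans (high-reaches-low {b = lo _} la (lo-low _)) (low-hub-reaches-high-hub (lo-low _) hb)
      ... | low with <-cmp v w
      ...   | tri≈ _ refl _ = Reach-mono (s≤s (s≤s z≤n)) (low-hub-reaches-high-hub la hb)
      ...   | tri> _ _ w<v  = Reach-mono (n≤1+n 3)
        (Reach-trans (low-hub-reaches-high-hub la (hi-high _))
                     (arc (descend w<v (trans (hi-high _) (sym hb)))))
      ...   | tri< v<w _ _  = Reach-mono (n≤1+n 3)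
        (step {w = ((suc ℓ , v) , hi _)} (hub⇒leaf (λ ()) la)
              (step (hi⇒lo (<⇒≢ v<w)) (arc (leaf⇒hub (λ ()) hb))))

      reaches-leaf : ∀ x {j w b} → Leaf j → Reach _⟶_ 4 x ((j , w) , b)
      reaches-leaf x {w = w} l =
        Reach-trans (reaches-low-hub x w (lo-low _)) (arc (hub⇒leaf l (lo-low _)))

      diameter≤4 : ∀ x y → Reach _⟶_ 4 x y
      diameter≤4 x ((suc j , w) , b) = reaches-leaf x (λ ())
      diameter≤4 x ((zero , w) , b) with level b in lb
      ... | low  = Reach-mono (n≤1+n 3) (reaches-low-hub x w lb)
      ... | high = reaches-high-hub x w lb

      ⟶⊆Adj : ∀ {x y} → x ⟶ y → Adj Gˢ x y
      ⟶⊆Adj (high⇒low v≢w _ _) = inj₁ (refl , v≢w)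
      ⟶⊆Adj (descend w<v _)    = inj₁ (refl , ≢-sym (<⇒≢ w<v))
      ⟶⊆Adj (hub⇒leaf l _)     = inj₂ (inj₁ (refl , l) , refl)
      ⟶⊆Adj (leaf⇒hub l _)     = inj₂ (inj₂ (refl , l) , refl)

      same-level : ∀ {i v w a b} → v ≢ w → level a ≡ level b →
                   ((i , v) , a) ⟶ ((i , w) , b) ⊎ ((i , w) , b) ⟶ ((i , v) , a)
      same-level {v = v} {w} v≢w eq with <-cmp v w
      ... | tri< v<w _ _ = inj₂ (descend v<w (sym eq))
      ... | tri≈ _ v≡w _ = ⊥-elim (v≢w v≡w)
      ... | tri> _ _ w<v = inj₁ (descend w<v eq)

      ⟶-total : ∀ {x y} → Adj Gˢ x y → x ⟶ y ⊎ y ⟶ x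
      ⟶-total {(i , v) , a} {(_ , w) , b} (inj₁ (refl , v≢w)) with level a in la | level b in lb
      ... | high | low  = inj₁ (high⇒low v≢w la lb)
      ... | low  | high = inj₂ (high⇒low (≢-sym v≢w) lb la)
      ... | high | high = same-level v≢w (trans la (sym lb))
      ... | low  | low  = same-level v≢w (trans la (sym lb))
      ⟶-total {(_ , v) , a} (inj₂ (inj₁ (refl , l) , refl)) with level a in la
      ... | low  = inj₁ (hub⇒leaf l la)
      ... | high = inj₂ (leaf⇒hub l la)
      ⟶-total {y = (_ , v) , b} (inj₂ (inj₂ (refl , l) , refl)) with level b in lb
      ... | low  = inj₂ (hub⇒leaf l lb)
      ... | high = inj₁ (leaf⇒hub l lb)

      ⟶-antisym : ∀ {x y} → x ⟶ y → y ⟶ x → ⊥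
      ⟶-antisym (high⇒low _ ha _)  (high⇒low _ _ la)  = low≢high (trans (sym la) ha)
      ⟶-antisym (high⇒low _ ha lb) (descend _ eq)     = low≢high (trans (sym lb) (trans eq ha))
      ⟶-antisym (descend _ eq)     (high⇒low _ hb la) = low≢high (trans (sym la) (trans eq hb))
      ⟶-antisym (descend w<v _)    (descend v<w _)    = <-asym w<v v<w
      ⟶-antisym (high⇒low _ _ _)   (hub⇒leaf l _)     = l refl
      ⟶-antisym (high⇒low _ _ _)   (leaf⇒hub l _)     = l refl
      ⟶-antisym (descend _ _)      (hub⇒leaf l _)     = l refl
      ⟶-antisym (descend _ _)      (leaf⇒hub l _)     = l refl
      ⟶-antisym (hub⇒leaf l _)     (high⇒low _ _ _)   = l refl
      ⟶-antisym (hub⇒leaf l _)     (descend _ _)      = l refl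
      ⟶-antisym (hub⇒leaf l _)     (hub⇒leaf _ _)     = l refl
      ⟶-antisym (hub⇒leaf _ la)    (leaf⇒hub _ ha)    = low≢high (trans (sym la) ha)
      ⟶-antisym (leaf⇒hub l _)     (high⇒low _ _ _)   = l refl
      ⟶-antisym (leaf⇒hub l _)     (descend _ _)      = l refl
      ⟶-antisym (leaf⇒hub _ hb)    (hub⇒leaf _ lb)    = low≢high (trans (sym lb) hb)
      ⟶-antisym (leaf⇒hub l _)     (leaf⇒hub _ _)     = l refl

      orientation : Orientation Gˢ
      orientation = record { Arc = _⟶_ ; arc⊆ = ⟶⊆Adj ; total = ⟶-total ; antisym = ⟶-antisym }

    orientation-number≡4 : Fin k → ((v : Fin μ) → ∃ λ u → u ≢ v) →
                           (v : Fin μ) → s (zero , v) C (s (zero , v) / 2) < k → OrientationNumber Gˢ 4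
    orientation-number≡4 ℓ another v many-leaves =
      (orientation , (λ x y → 4 , diameter≤4 x y) , diameter≤4) , no-strong-orientation-of-diameter-3
      where
      open Orientation₄ ℓ another
      no-strong-orientation-of-diameter-3 : ∀ D → Strong D → ∀ j → suc j ≡ 4 →
                                            Σ (V Gˢ) λ x → Σ (V Gˢ) λ y → ¬ Reach (Arc D) j x y
      no-strong-orientation-of-diameter-3 D _ .3 refl = diameter>3 v many-leaves D

another : ∀ {n} (v : Fin (suc (suc n))) → ∃ λ u → u ≢ v
another zero    = suc zero , λ ()
another (suc _) = zero , λ ()

proposition4p2 : (μ k : ℕ) → 3 ≤ μ → 2 ≤ k
    → (s : Fin (suc k) × Fin μ → ℕ) → (∀ w → 2 ≤ s w)
    → (m : ℕ) → (∀ v → m ≤ s (zero , v)) → (∃ λ v → s (zero , v) ≡ m)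
    → m C (m / 2) < k
    → InC1 (Star k □ Complete μ) s
proposition4p2 .(suc (suc (suc _))) .(suc (suc _)) (s≤s (s≤s (s≤s _))) (s≤s (s≤s _))
               s s≥2 _ _ (v , refl) many-leaves =
  (λ p q → 3 , G-diameter≤3 p q) , s≥2 , 3 ,
  G-diameter≡3 {suc zero} {suc (suc zero)} {zero} {suc zero} (λ ()) (λ ()) (λ ()) (λ ()) ,
  orientation-number≡4 zero another v many-leaves
  where
  open StarProduct _ _
  open Multiplication s s≥2
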